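{- (1) For every $n\ge1$ and every path set $\mathcal{P}\subset\mathcal{A}^{\mathbb{N}}$, the $n$-interleaving $\mathcal{P}^{(*n)}$ is a path set. (2) There is an algorithm which, given $n$ and a path set presentation $\mathcal{G}$ of $\mathcal{P}$, produces a path set presentation $\mathcal{H}$ of $\mathcal{P}^{(*n)}$; if $\mathcal{G}$ has $k$ vertices and $m$ edges, then $\mathcal{H}$ has $k^n$ vertices and $mk^{n-1}$ edges.
   Context: $\mathcal{A}$ is a finite alphabet and $\mathcal{A}^{\mathbb{N}}$ the set of one-sided infinite sequences $(x_0,x_1,\dots)$. A path set presentation is a pair $(\mathcal{G},v)$ where $\mathcal{G}$ is a finite directed graph (loops and multiple edges allowed) with each edge labeled by a symbol of $\mathcal{A}$ and $v$ is a marked vertex; the path set it presents is the set of label sequences of all infinite directed walks in $\mathcal{G}$ starting at $v$. A path set is a subset of $\mathcal{A}^{\mathbb{N}}$ having such a presentation. For $n\ge1$ and a closed set $\mathcal{X}\subset\mathcal{A}^{\mathbb{N}}$, the $n$-interleaving is $\mathcal{X}^{(*n)}=\{(x_i)_{i\ge0}\in\mathcal{A}^{\mathbb{N}}: (x_j,x_{j+n},x_{j+2n},\dots)\in\mathcal{X}\text{ for all }0\le j\le n-1\}$. -}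

module Defs where

open import Data.Nat using (ℕ; suc; _+_; _*_; _<_)
open import Data.Fin using (Fin)
open import Data.Product using (Σ; _×_; ∃)
open import Relation.Binary.PropositionalEquality using (_≡_)
open import Function.Bundles using (_⇔_)

Seq : Set → Set
Seq A = ℕ → A

SeqSet : Set → Set₁
SeqSet A = Seq A → Set

record LabeledGraph (A : Set) : Set where
  field
    k   : ℕ
    m   : ℕ
    src : Fin m → Fin k
    tgt : Fin m → Fin k
    lab : Fin m → A
open LabeledGraph public

record Presentation (A : Set) : Set where
  constructor _,_
  field
    graph  : LabeledGraph A
    marked : Fin (k graph)
open Presentation public

record Walk {A : Set} (P : Presentation A) : Set where
  field
    edge   : ℕ → Fin (m (graph P))
    starts : src (graph P) (edge 0) ≡ marked P
    chains : ∀ i → tgt (graph P) (edge i) ≡ src (graph P) (edge (suc i))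
open Walk public

PathSetOf : {A : Set} → Presentation A → SeqSet A
PathSetOf P x = Σ (Walk P) λ w → ∀ i → lab (graph P) (edge w i) ≡ x i

Presents : {A : Set} → Presentation A → SeqSet A → Set
Presents P X = ∀ x → (X x ⇔ PathSetOf P x)

IsPathSet : {A : Set} → SeqSet A → Set
IsPathSet {A} X = Σ (Presentation A) λ P → Presents P X

Interleave : {A : Set} → ℕ → SeqSet A → SeqSet A
Interleave n X x = ∀ j → j < n → X (λ i → x (j + i * n))

module Submission where

-- For n = suc p we build the "shift-register" presentation of P^(*n):
-- a vertex is a window (u₀, …, u_p) of n vertices of G, and an edge
-- from it is an edge e of G leaving u₀, labelled like e, leading to the
-- shifted window (u₁, …, u_p, tgt e).  Hence there are k^n vertices and
-- m·k^(n-1) edges (an edge of G plus the p window entries u₁, …, u_p).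
--
-- Both directions of the correctness proof pass through one notion: an
-- n-strided edge sequence of G, i.e. e : ℕ → edges with src (e j) = v
-- for j < n and tgt (e t) = src (e (t + n)).  Such sequences are exactly
-- the interleavings of n walks of G from v ('decimate', 'interleaveWalks'),
-- and exactly the G-components of the walks of the shift register from
-- the constant window (v, …, v) ('runWalk', 'projectRun').  Finally the
-- interleaving respects equivalence of sets, which gives part (1) for
-- an arbitrary presented set X.

open import Defs
open import Data.Nat using (ℕ; zero; suc; _+_; _*_; _^_; _∸_; _≤_; _<_; _%_; _/_)
open import Data.Nat.Properties using (+-identityʳ; +-suc; +-assoc; +-comm; suc-injective; <-irrelevant; m≤n+m; m+n∸n≡m)
open import Data.Nat.DivMod using (m%n<n; m≡m%n+[m/n]*n; [m+n]%n≡m%n; m/n≡1+[m∸n]/n; m<n⇒m%n≡m; m<n⇒m/n≡0)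
open import Data.Fin using (Fin; zero; suc; toℕ; fromℕ; fromℕ<; inject₁; combine; remQuot; funToFin; finToFun)
open import Data.Fin.Properties using (remQuot-combine; finToFun-funToFin; toℕ-fromℕ<; toℕ-inject₁; toℕ-fromℕ; toℕ<n)
open import Data.Product using (Σ; _×_; _,_; proj₁; proj₂)
open import Relation.Binary.PropositionalEquality using (_≡_; refl; sym; trans; cong; cong₂; module ≡-Reasoning)
open import Function using (_∘_)
open import Function.Bundles using (_⇔_; mk⇔; Equivalence)
import Function.Properties.Equivalence as ⇔

open ≡-Reasoning

snoc : {X : Set} {p : ℕ} → (Fin p → X) → X → Fin (suc p) → X
snoc {p = zero}  f x _       = x
snoc {p = suc p} f x zero    = f zero
snoc {p = suc p} f x (suc c) = snoc (f ∘ suc) x c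

snoc-inject₁ : {X : Set} {p : ℕ} (f : Fin p → X) (x : X) (c : Fin p) → snoc f x (inject₁ c) ≡ f c
snoc-inject₁ {p = suc p} f x zero    = refl
snoc-inject₁ {p = suc p} f x (suc c) = snoc-inject₁ (f ∘ suc) x c

snoc-last : {X : Set} (p : ℕ) (f : Fin p → X) (x : X) → snoc f x (fromℕ p) ≡ x
snoc-last zero    f x = refl
snoc-last (suc p) f x = snoc-last p (f ∘ suc) x

snoc-unique : {X : Set} {p : ℕ} (f : Fin p → X) (x : X) (g : Fin (suc p) → X) →
  (∀ c → f c ≡ g (inject₁ c)) → x ≡ g (fromℕ p) → ∀ c → snoc f x c ≡ g c
snoc-unique {p = zero}  f x g hf hx zero    = hx
snoc-unique {p = suc p} f x g hf hx zero    = hf zero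
snoc-unique {p = suc p} f x g hf hx (suc c) = snoc-unique (f ∘ suc) x (g ∘ suc) (hf ∘ suc) hx c

-- Tuples Fin a → Fin b are coded as Fin (b ^ a) by funToFin; without
-- function extensionality we need both directions of its injectivity
-- in pointwise form.
funToFin-cong : {a b : ℕ} (f g : Fin a → Fin b) → (∀ c → f c ≡ g c) → funToFin f ≡ funToFin g
funToFin-cong {zero}  f g f≗g = refl
funToFin-cong {suc a} f g f≗g = cong₂ combine (f≗g zero) (funToFin-cong (f ∘ suc) (g ∘ suc) (f≗g ∘ suc))

funToFin-injective : {a b : ℕ} (f g : Fin a → Fin b) → funToFin f ≡ funToFin g → ∀ c → f c ≡ g c
funToFin-injective f g eq c = begin
  f c                     ≡⟨ finToFun-funToFin f c ⟨
  finToFun (funToFin f) c ≡⟨ cong (λ z → finToFun z c) eq ⟩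
  finToFun (funToFin g) c ≡⟨ finToFun-funToFin g c ⟩
  g c                     ∎

interleave-cong : {A : Set} (n : ℕ) {X Y : SeqSet A} →
  (∀ x → X x ⇔ Y x) → ∀ x → Interleave n X x ⇔ Interleave n Y x
interleave-cong n X⇔Y x = mk⇔
  (λ ix j j<n → Equivalence.to   (X⇔Y _) (ix j j<n))
  (λ iy j j<n → Equivalence.from (X⇔Y _) (iy j j<n))

module Interleaving {A : Set} (P : Presentation A) (p : ℕ) where
  G = graph P
  K = k G
  M = m G
  v = marked P
  N = suc p

  record IsStrided (e : ℕ → Fin M) : Set where
    field
      first : ∀ j → j < N → src G (e j) ≡ v
      jump  : ∀ t → tgt G (e t) ≡ src G (e (t + N))
  open IsStrided

  decimate : {e : ℕ → Fin M} → IsStrided e → (j : ℕ) → j < N → Walk P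
  decimate {e} s j j<N = record { edge = λ i → e (j + i * N) ; starts = starts′ ; chains = chains′ }
    where
    starts′ : src G (e (j + 0)) ≡ v
    starts′ = trans (cong (src G ∘ e) (+-identityʳ j)) (first s j j<N)
    next : ∀ i → (j + i * N) + N ≡ j + suc i * N
    next i = trans (+-assoc j (i * N) N) (cong (j +_) (+-comm (i * N) N))
    chains′ : ∀ i → tgt G (e (j + i * N)) ≡ src G (e (j + suc i * N))
    chains′ i = trans (jump s (j + i * N)) (cong (src G ∘ e) (next i))

  module Interleaved (W : (j : ℕ) → j < N → Walk P) where
    walkAt : ℕ → Walk P
    walkAt t = W (t % N) (m%n<n t N)

    edges : ℕ → Fin M
    edges t = edge (walkAt t) (t / N)

    W-cong : ∀ {i j} → i ≡ j → (i<N : i < N) (j<N : j < N) → W i i<N ≡ W j j<N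
    W-cong refl i<N j<N = cong (W _) (<-irrelevant i<N j<N)

    quotient-step : ∀ t → (t + N) / N ≡ suc (t / N)
    quotient-step t = trans (m/n≡1+[m∸n]/n (m≤n+m N t)) (cong (λ u → suc (u / N)) (m+n∸n≡m t N))

    strided : IsStrided edges
    first strided j j<N = begin
      src G (edge (walkAt j) (j / N)) ≡⟨ cong₂ (λ w i → src G (edge w i))
                                           (W-cong (m<n⇒m%n≡m j<N) _ j<N) (m<n⇒m/n≡0 j<N) ⟩
      src G (edge (W j j<N) 0)        ≡⟨ starts (W j j<N) ⟩
      v                               ∎
    jump strided t = begin
      tgt G (edge (walkAt t) (t / N))           ≡⟨ chains (walkAt t) (t / N) ⟩
      src G (edge (walkAt t) (suc (t / N)))     ≡⟨ cong₂ (λ w i → src G (edge w i))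
                                                     (W-cong (sym ([m+n]%n≡m%n t N)) _ _) (sym (quotient-step t)) ⟩
      src G (edge (walkAt (t + N)) ((t + N) / N)) ∎

  -- The shift-register graph H.  A move is an edge e of G together with
  -- the window entries u₁, …, u_p; it goes from (src e, u₁, …, u_p) to
  -- (u₁, …, u_p, tgt e).
  Window : Set
  Window = Fin N → Fin K

  Move : Set
  Move = Fin M × (Fin p → Fin K)

  encode : Move → Fin (M * K ^ p)
  encode (e , u) = combine e (funToFin u)

  decode : Fin (M * K ^ p) → Move
  decode i = proj₁ (remQuot {M} (K ^ p) i) , finToFun (proj₂ (remQuot {M} (K ^ p) i))

  decode-encode₁ : ∀ mv → proj₁ (decode (encode mv)) ≡ proj₁ mv
  decode-encode₁ (e , u) = cong proj₁ (remQuot-combine {M} {K ^ p} e (funToFin u))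

  decode-encode₂ : ∀ mv c → proj₂ (decode (encode mv)) c ≡ proj₂ mv c
  decode-encode₂ (e , u) c = trans (cong (λ r → finToFun (proj₂ r) c) (remQuot-combine {M} {K ^ p} e (funToFin u)))
                                   (finToFun-funToFin u c)

  before : Move → Window
  before (e , u) zero    = src G e
  before (e , u) (suc c) = u c

  after : Move → Window
  after (e , u) = snoc u (tgt G e)

  H : LabeledGraph A
  H = record { k = K ^ N ; m = M * K ^ p
             ; src = funToFin ∘ before ∘ decode
             ; tgt = funToFin ∘ after ∘ decode
             ; lab = lab G ∘ proj₁ ∘ decode }

  shiftRegister : Presentation A
  shiftRegister = H , funToFin (λ (_ : Fin N) → v)

  module Run {e : ℕ → Fin M} (s : IsStrided e) where
    window : ℕ → Window
    window t c = src G (e (t + toℕ c))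

    move : ℕ → Move
    move t = e t , λ c → window (suc t) (inject₁ c)

    before-move : ∀ t c → before (decode (encode (move t))) c ≡ window t c
    before-move t zero    = trans (cong (src G) (decode-encode₁ (move t))) (cong (src G ∘ e) (sym (+-identityʳ t)))
    before-move t (suc c) = begin
      proj₂ (decode (encode (move t))) c ≡⟨ decode-encode₂ (move t) c ⟩
      src G (e (suc t + toℕ (inject₁ c))) ≡⟨ cong (λ u → src G (e (suc t + u))) (toℕ-inject₁ c) ⟩
      src G (e (suc t + toℕ c))           ≡⟨ cong (src G ∘ e) (sym (+-suc t (toℕ c))) ⟩
      window t (suc c)                    ∎

    -- The new last entry tgt (e t) is src (e (t + N)) by the stride condition.
    after-move : ∀ t c → after (decode (encode (move t))) c ≡ window (suc t) c
    after-move t = snoc-unique _ _ (window (suc t)) (decode-encode₂ (move t)) last-entry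
      where
      last-entry : tgt G (proj₁ (decode (encode (move t)))) ≡ window (suc t) (fromℕ p)
      last-entry = begin
        tgt G (proj₁ (decode (encode (move t)))) ≡⟨ cong (tgt G) (decode-encode₁ (move t)) ⟩
        tgt G (e t)                              ≡⟨ jump s t ⟩
        src G (e (t + N))                        ≡⟨ cong (src G ∘ e) (+-suc t p) ⟩
        src G (e (suc t + p))                    ≡⟨ cong (λ u → src G (e (suc t + u))) (sym (toℕ-fromℕ p)) ⟩
        window (suc t) (fromℕ p)                 ∎

    runWalk : Walk shiftRegister
    runWalk = record
      { edge   = encode ∘ move
      ; starts = funToFin-cong _ _ (λ c → trans (before-move 0 c) (first s (toℕ c) (toℕ<n c)))
      ; chains = λ t → funToFin-cong _ _ (λ c → trans (after-move t c) (sym (before-move (suc t) c))) }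

    runWalk-label : ∀ t → lab H (edge runWalk t) ≡ lab G (e t)
    runWalk-label t = cong (lab G) (decode-encode₁ (move t))

  -- Conversely, the G-components of any walk of H from (v, …, v) form a
  -- strided sequence: each window entry reappears, shifted one place
  -- to the left per step, as the first entry, i.e. as a source in G.
  module Project (w : Walk shiftRegister) where
    moves : ℕ → Move
    moves = decode ∘ edge w

    edges : ℕ → Fin M
    edges = proj₁ ∘ moves

    window : ℕ → Window
    window = before ∘ moves

    after≗window : ∀ t c → after (moves t) c ≡ window (suc t) c
    after≗window t = funToFin-injective _ _ (chains w t)

    slide : ∀ t (c : Fin p) → window (suc t) (inject₁ c) ≡ window t (suc c)
    slide t c = trans (sym (after≗window t (inject₁ c))) (snoc-inject₁ _ _ c)

    delay : ∀ s (c : Fin N) → toℕ c ≡ s → ∀ t → window (t + s) zero ≡ window t c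
    delay zero    zero    _   t = cong (λ u → window u zero) (+-identityʳ t)
    delay (suc s) (suc c) c≡s t = begin
      window (t + suc s) zero      ≡⟨ cong (λ u → window u zero) (+-suc t s) ⟩
      window (suc t + s) zero      ≡⟨ delay s (inject₁ c) (trans (toℕ-inject₁ c) (suc-injective c≡s)) (suc t) ⟩
      window (suc t) (inject₁ c)   ≡⟨ slide t c ⟩
      window t (suc c)             ∎

    projectRun : IsStrided edges
    first projectRun j j<N = begin
      window j zero                  ≡⟨ cong (λ u → window u zero) (sym (toℕ-fromℕ< j<N)) ⟩
      window (0 + toℕ c) zero        ≡⟨ delay _ c refl 0 ⟩
      window 0 c                     ≡⟨ funToFin-injective (window 0) (λ _ → v) (starts w) c ⟩
      v                              ∎
      where c = fromℕ< j<N
    jump projectRun t = begin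
      tgt G (edges t)                ≡⟨ snoc-last p _ _ ⟨
      after (moves t) (fromℕ p)      ≡⟨ after≗window t (fromℕ p) ⟩
      window (suc t) (fromℕ p)       ≡⟨ delay p (fromℕ p) (toℕ-fromℕ p) (suc t) ⟨
      window (suc t + p) zero        ≡⟨ cong (λ u → window u zero) (sym (+-suc t p)) ⟩
      window (t + N) zero            ∎

  shiftRegister-presents : Presents shiftRegister (Interleave N (PathSetOf P))
  shiftRegister-presents x = mk⇔ to from
    where
    to : Interleave N (PathSetOf P) x → PathSetOf shiftRegister x
    to ix = runWalk , labels
      where
      open Interleaved (λ j j<N → proj₁ (ix j j<N))
      open Run strided
      labels : ∀ t → lab H (edge runWalk t) ≡ x t
      labels t = begin
        lab H (edge runWalk t)                 ≡⟨ runWalk-label t ⟩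
        lab G (edges t)                        ≡⟨ proj₂ (ix (t % N) (m%n<n t N)) (t / N) ⟩
        x (t % N + (t / N) * N)                ≡⟨ cong x (m≡m%n+[m/n]*n t N) ⟨
        x t                                    ∎
    from : PathSetOf shiftRegister x → Interleave N (PathSetOf P) x
    from (w , labels) j j<N = decimate (Project.projectRun w) j j<N , λ i → labels (j + i * N)

-- The presentation transformer of part (2); its value at n = 0 is irrelevant
-- since every claim assumes 1 ≤ n.
interleavePresentation : {A : Set} → ℕ → Presentation A → Presentation A
interleavePresentation zero    P = P
interleavePresentation (suc p) P = Interleaving.shiftRegister P p

interleave-isPathSet : {A : Set} (n : ℕ) → 1 ≤ n → (X : SeqSet A) → IsPathSet X → IsPathSet (Interleave n X)
interleave-isPathSet (suc p) _ X (P , P-presents-X) =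
  Interleaving.shiftRegister P p , λ x →
    ⇔.trans (interleave-cong (suc p) P-presents-X x) (Interleaving.shiftRegister-presents P p x)

proposition3p4 : (a : ℕ) →
    ((n : ℕ) → 1 ≤ n → (X : SeqSet (Fin a)) → IsPathSet X → IsPathSet (Interleave n X))
    × Σ ((n : ℕ) → Presentation (Fin a) → Presentation (Fin a)) (λ F →
        (n : ℕ) → 1 ≤ n → (P : Presentation (Fin a)) →
          Presents (F n P) (Interleave n (PathSetOf P))
          × k (graph (F n P)) ≡ k (graph P) ^ n
          × m (graph (F n P)) ≡ m (graph P) * k (graph P) ^ (n ∸ 1))
proposition3p4 a = interleave-isPathSet , interleavePresentation , correct
  where
  correct : (n : ℕ) → 1 ≤ n → (P : Presentation (Fin a)) →
    Presents (interleavePresentation n P) (Interleave n (PathSetOf P))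
    × k (graph (interleavePresentation n P)) ≡ k (graph P) ^ n
    × m (graph (interleavePresentation n P)) ≡ m (graph P) * k (graph P) ^ (n ∸ 1)
  correct (suc p) _ P = Interleaving.shiftRegister-presents P p , refl , refl
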